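{- Let $n,k$ be integers with $2\le k\le n-2$, and let $d,n_1=1,n_2,n_3$ be the parameters associated with a circulant minor of $C_n^k$ such that $n_3\equiv r\pmod{k-d}$ with $1\le r<k-d$. Then \[ \left\lceil\frac{n-d(n_2+n_3)}{k-d}\right\rceil=\left(\frac{n}{k}-\frac{r}{k-d}+1\right)+\frac{1}{k(k-d)}\,dn_3 . \]
   Context: $\mathbb{Z}_n=\{0,\dots,n-1\}$ with arithmetic modulo $n$. $C_n^k$ is the $n\times n$ $0,1$ matrix with rows and columns indexed by $\mathbb{Z}_n$ whose $i$-th row is the incidence vector of $\{i,\dots,i+k-1\}\subset\mathbb{Z}_n$. For $N\subset\mathbb{Z}_n$, let $R(N)$ be the set of rows $j$ such that row $j$ of the column-submatrix of $C_n^k$ on columns $\mathbb{Z}_n\setminus N$ entrywise dominates some other row of that submatrix; the minor $C_n^k/N$ is the submatrix with rows $\mathbb{Z}_n\setminus R(N)$ and columns $\mathbb{Z}_n\setminus N$; a circulant minor is one isomorphic (up to row and column permutations) to some $C_{n'}^{k'}$. Let $G(C_n^k)$ be the digraph on $\mathbb{Z}_n$ with arcs $(i,i+k)$ (length $k$) and $(i,i+k+1)$ (length $k+1$). It is known that $C_n^k/N\approx C_{n'}^{k'}$ iff $N$ is the disjoint union of sets $N^0,\dots,N^{d-1}$, each the vertex set of a simple directed cycle of $G(C_n^k)$, all with the same number $n_2$ of arcs of length $k$ and $n_3$ of arcs of length $k+1$, where $n_1n=kn_2+(k+1)n_3$ with $n_1$ a positive integer, and $n'=n-d(n_2+n_3)$,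 $k'=k-dn_1$; $d,n_1,n_2,n_3$ are the parameters associated with the minor. -}

module Defs where

open import Data.Nat using (ℕ; zero; suc; _+_; _*_; _∸_; _<_; _≤_; _%_)
open import Data.Nat.Divisibility using (_∣_)
open import Data.Bool using (Bool; true; false)
open import Data.List using (List; []; _∷_; length)
open import Data.Fin using (Fin)
open import Data.Product using (Σ; _×_)
open import Data.Integer using (ℤ; +_)
import Data.Rational as ℚ
open import Relation.Binary.PropositionalEquality using (_≡_; _≢_)

-- reduction modulo n (n = 0 never occurs in our use; convention: identity)
_mod'_ : ℕ → ℕ → ℕ
x mod' zero  = x
x mod' suc m = x % suc m

-- rational number a / b, with the convention a / 0 = 0 (denominators below are
-- nonzero under the hypotheses of the theorem)
frac : ℤ → ℕ → ℚ.ℚ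
frac a zero    = ℚ.0ℚ
frac a (suc b) = a ℚ./ suc b

fromℤ : ℤ → ℚ.ℚ
fromℤ a = frac a 1

-- An arc of G(C_n^k) is encoded by a Bool: false = arc of length k,
-- true = arc of length k+1.
arcLen : ℕ → Bool → ℕ
arcLen k false = k
arcLen k true  = suc k

partial : ℕ → List Bool → ℕ → ℕ
partial k _        zero    = 0
partial k []       (suc j) = 0
partial k (b ∷ bs) (suc j) = arcLen k b + partial k bs j

countArcs : Bool → List Bool → ℕ
countArcs c [] = 0
countArcs false (false ∷ bs) = suc (countArcs false bs)
countArcs false (true  ∷ bs) = countArcs false bs
countArcs true  (false ∷ bs) = countArcs true bs
countArcs true  (true  ∷ bs) = suc (countArcs true bs)

-- A simple directed cycle of G(C_n^k) (vertex set ℤ_n, arcs (i,i+k), (i,i+k+1)):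
-- a start vertex and a nonempty list of arcs; the j-th vertex is
-- start + (lengths of the first j arcs) mod n; the vertices are pairwise distinct
-- and the walk closes up (total length divisible by n).
record Cycle (n k : ℕ) : Set where
  field
    start    : ℕ
    start<n  : start < n
    arcs     : List Bool
    nonempty : 1 ≤ length arcs
    closed   : n ∣ partial k arcs (length arcs)
  vertex : ℕ → ℕ
  vertex j = (start + partial k arcs j) mod' n
  field
    simple   : ∀ i j → i < length arcs → j < length arcs → vertex i ≡ vertex j → i ≡ j

open Cycle public

n₂Of : ∀ {n k} → Cycle n k → ℕ
n₂Of c = countArcs false (arcs c)

n₃Of : ∀ {n k} → Cycle n k → ℕ
n₃Of c = countArcs true (arcs c)

DisjointCycles : ∀ {n k} → Cycle n k → Cycle n k → Set
DisjointCycles c c' = ∀ i j → i < length (arcs c) → j < length (arcs c') →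
                      vertex c i ≢ vertex c' j

-- (d, n₁, n₂, n₃) are the parameters associated with a circulant minor C_n^k / N,
-- N = N^0 ∪ ... ∪ N^{d-1}: d pairwise vertex-disjoint simple directed cycles of
-- G(C_n^k), each with n₂ arcs of length k and n₃ arcs of length k+1, where
-- n₁ n = k n₂ + (k+1) n₃ with n₁ a positive integer.
CirculantMinorParams : (n k d n₁ n₂ n₃ : ℕ) → Set
CirculantMinorParams n k d n₁ n₂ n₃ =
  (1 ≤ n₁) × (n₁ * n ≡ k * n₂ + suc k * n₃) ×
  Σ (Fin d → Cycle n k) λ cyc →
      (∀ a → n₂Of (cyc a) ≡ n₂ × n₃Of (cyc a) ≡ n₃) ×
      (∀ a b → a ≢ b → DisjointCycles (cyc a) (cyc b))

module Submission where

-- Write m = k − d, n₃ = q m + r and A = n₂ + n₃ + q.  The argument has three parts.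
--  * Arithmetic: from n = k n₂ + (k+1) n₃ we get the two polynomial identities
--      n − d(n₂+n₃) = A m + r     and     A k m + r k = n m + d n₃.
--  * Ceiling: since 0 < r < m, ⌈(A m + r)/m⌉ = A + 1.  The standard library has no
--    theory of ⌈_⌉ on ℚ, so we compute it from its definition on the normalised
--    fraction, comparing quotients and remainders of equal fractions.
--  * Fractions: the second identity, divided by k m, says exactly that the
--    right-hand side of the lemma equals A + 1; this is checked on unnormalised
--    rationals, where it becomes a ring identity over ℤ.
-- The lemma itself only needs n₁ n = k n₂ + (k+1) n₃ from the minor's parameters.

open import Data.Nat using (ℕ; zero; suc; _+_; _*_; _∸_; _<_; _≤_; _%_; _/_; NonZero; z≤n)
open import Data.Nat.Properties
open import Data.Nat.DivMod
open import Data.Nat.Divisibility using (n∣m*n)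
open import Data.Nat.Tactic.RingSolver using (solve)
open import Data.Integer as ℤ using (ℤ; +_; -[1+_])
import Data.Integer.Properties as ℤP
import Data.Integer.Tactic.RingSolver as ℤSolver
import Data.Rational as ℚ
open import Data.Rational using (ℚ; mkℚ)
import Data.Rational.Properties as ℚP
import Data.Rational.Unnormalised as ℚᵘ
open import Data.Rational.Unnormalised using (mkℚᵘ; *≡*)
import Data.Rational.Unnormalised.Properties as ℚᵘP
open import Data.List using ([]; _∷_)
open import Data.Empty using (⊥-elim)
open import Data.Product using (Σ; _,_)
open import Relation.Binary.PropositionalEquality
open import Defs

cross-quotient : ∀ N D X M → N * suc M ≡ X * suc D → N / suc D ≡ X / suc M
cross-quotient N D X M eq = begin
  N / suc D                   ≡⟨ m*n/o*n≡m/o N (suc M) (suc D) ⟨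
  N * suc M / (suc D * suc M) ≡⟨ /-congˡ {o = suc D * suc M} eq ⟩
  X * suc D / (suc D * suc M) ≡⟨ /-congʳ {m = X * suc D} (*-comm (suc D) (suc M)) ⟩
  X * suc D / (suc M * suc D) ≡⟨ m*n/o*n≡m/o X (suc D) (suc M) ⟩
  X / suc M                   ∎
  where open ≡-Reasoning

cross-remainder : ∀ N D X M → N * suc M ≡ X * suc D →
                  N % suc D * suc M ≡ X % suc M * suc D
cross-remainder N D X M eq = begin
  N % suc D * suc M           ≡⟨ m%n*o≡m*o%[n*o] N (suc D) (suc M) ⟩
  N * suc M % (suc D * suc M) ≡⟨ %-congˡ {o = suc D * suc M} eq ⟩
  X * suc D % (suc D * suc M) ≡⟨ %-congʳ {o = X * suc D} (*-comm (suc D) (suc M)) ⟩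
  X * suc D % (suc M * suc D) ≡⟨ m%n*o≡m*o%[n*o] X (suc M) (suc D) ⟨
  X % suc M * suc D           ∎
  where open ≡-Reasoning

-- Integer division rounds towards −∞: dividing −(n+1) by d, when d ∤ n+1,
-- gives −(⌊(n+1)/d⌋ + 1).  This is what makes ⌈_⌉ = −⌊−_⌋ round up.
negsuc-/ℕ : ∀ n d .{{_ : NonZero d}} → suc n % d ≢ 0 → -[1+ n ] ℤ./ℕ d ≡ -[1+ suc n / d ]
negsuc-/ℕ n d d∤ with suc n % d
... | zero  = ⊥-elim (d∤ refl)
... | suc _ = refl

ceiling-frac : ∀ X m → X % suc m ≢ 0 → ℚ.ceiling (frac (+ X) (suc m)) ≡ + suc (X / suc m)
ceiling-frac zero    m X∤ = ⊥-elim (X∤ refl)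
ceiling-frac (suc X) m X∤ =
  ceiling-normal (frac (+ suc X) (suc m)) (ℚP.toℚᵘ-fromℚᵘ (mkℚᵘ (+ suc X) m))
  where
  -- the normal form N/(D+1) of the fraction has N positive, so ⌈_⌉ unfolds
  -- to a division of −N, which is then compared with X/(m+1)
  ceiling-normal : (p : ℚ) → ℚ.toℚᵘ p ℚᵘ.≃ mkℚᵘ (+ suc X) m → ℚ.ceiling p ≡ + suc (suc X / suc m)
  ceiling-normal (mkℚ (+ suc N) D _) (*≡* eq) = begin
    ℤ.- (+ 1 ℤ.* (-[1+ N ] ℤ./ℕ suc D)) ≡⟨ cong ℤ.-_ (ℤP.*-identityˡ _) ⟩
    ℤ.- (-[1+ N ] ℤ./ℕ suc D)           ≡⟨ cong ℤ.-_ (negsuc-/ℕ N (suc D) N∤) ⟩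
    + suc (suc N / suc D)               ≡⟨ cong (λ z → + suc z) (cross-quotient _ D _ m eqℕ) ⟩
    + suc (suc X / suc m)               ∎
    where
    open ≡-Reasoning
    eqℕ : suc N * suc m ≡ suc X * suc D
    eqℕ = ℤP.+-injective eq
    N∤ : suc N % suc D ≢ 0
    N∤ N%≡0 = X∤ (m*n≡0⇒m≡0 _ _ (trans (sym (cross-remainder _ D _ m eqℕ))
                                       (cong (_* suc m) N%≡0)))
  ceiling-normal (mkℚ (+ zero) D _)  (*≡* ())
  ceiling-normal (mkℚ -[1+ _ ] D _)  (*≡* ())

ceiling-quotient-remainder : ∀ A m r → 1 ≤ r → r < suc m →
  ℚ.ceiling (frac (+ (r + A * suc m)) (suc m)) ≡ + suc A
ceiling-quotient-remainder A m r 1≤r r<m = begin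
  ℚ.ceiling (frac (+ X) (suc m)) ≡⟨ ceiling-frac X m X∤ ⟩
  + suc (X / suc m)              ≡⟨ cong (λ z → + suc z) X/m≡A ⟩
  + suc A                        ∎
  where
  open ≡-Reasoning
  X : ℕ
  X = r + A * suc m
  X%m≡r : X % suc m ≡ r
  X%m≡r = trans ([m+kn]%n≡m%n r A (suc m)) (m<n⇒m%n≡m r<m)
  X∤ : X % suc m ≢ 0
  X∤ X%≡0 = <⇒≢ 1≤r (sym (trans (sym X%m≡r) X%≡0))
  X/m≡A : X / suc m ≡ A
  X/m≡A = trans (+-distrib-/-∣ʳ r (n∣m*n A)) (cong₂ _+_ (m<n⇒m/n≡0 r<m) (m*n/n≡m A (suc m)))

module _ {n k d n₂ n₃ m q r : ℕ}
         (n≡ : n ≡ k * n₂ + suc k * n₃) (k≡ : k ≡ m + d) (n₃≡ : n₃ ≡ q * m + r) where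

  reduced-numerator : n ≡ d * (n₂ + n₃) + (r + (n₂ + n₃ + q) * m)
  reduced-numerator rewrite n≡ | k≡ | n₃≡ = solve (m ∷ d ∷ n₂ ∷ q ∷ r ∷ [])

  scaled-identity : (n₂ + n₃ + q) * (k * m) + r * k ≡ n * m + d * n₃
  scaled-identity rewrite n≡ | k≡ | n₃≡ = solve (m ∷ d ∷ n₂ ∷ q ∷ r ∷ [])

-- Over ℤ, the cross-multiplied form of  (N/K − R/M + 1) + D/(KM) = 1 + A
-- (with the denominators produced by unnormalised addition) follows from
-- A K M + R K = N M + D.
cross-multiplied : ∀ (N R D A K M : ℤ) → A ℤ.* (K ℤ.* M) ℤ.+ R ℤ.* K ≡ N ℤ.* M ℤ.+ D →
  (((N ℤ.* M ℤ.+ ℤ.- R ℤ.* K) ℤ.* ℤ.1ℤ ℤ.+ ℤ.1ℤ ℤ.* (K ℤ.* M)) ℤ.* (K ℤ.* M)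
    ℤ.+ D ℤ.* (K ℤ.* M ℤ.* ℤ.1ℤ)) ℤ.* ℤ.1ℤ
  ≡ (ℤ.1ℤ ℤ.+ A) ℤ.* (K ℤ.* M ℤ.* ℤ.1ℤ ℤ.* (K ℤ.* M))
cross-multiplied N R D A K M hyp = begin
  _ ≡⟨ ℤSolver.solve (N ∷ R ∷ D ∷ K ∷ M ∷ []) ⟩
  (K ℤ.* M) ℤ.* ((N ℤ.* M ℤ.+ D) ℤ.- R ℤ.* K ℤ.+ K ℤ.* M)
    ≡⟨ cong (λ z → (K ℤ.* M) ℤ.* (z ℤ.- R ℤ.* K ℤ.+ K ℤ.* M)) hyp ⟨
  (K ℤ.* M) ℤ.* ((A ℤ.* (K ℤ.* M) ℤ.+ R ℤ.* K) ℤ.- R ℤ.* K ℤ.+ K ℤ.* M)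
    ≡⟨ ℤSolver.solve (A ∷ R ∷ K ∷ M ∷ []) ⟩
  _ ∎
  where open ≡-Reasoning

fraction-identity : ∀ (N R D A : ℤ) k m →
  A ℤ.* (+ suc k ℤ.* + suc m) ℤ.+ R ℤ.* + suc k ≡ N ℤ.* + suc m ℤ.+ D →
  ((frac N (suc k) ℚ.- frac R (suc m)) ℚ.+ ℚ.1ℚ) ℚ.+ frac D (suc k * suc m) ≡ fromℤ (ℤ.1ℤ ℤ.+ A)
fraction-identity N R D A k m hyp = ℚP.toℚᵘ-injective (begin
  ℚ.toℚᵘ (((n/k ℚ.- r/m) ℚ.+ ℚ.1ℚ) ℚ.+ D/km)
    ≈⟨ ℚP.toℚᵘ-homo-+ ((n/k ℚ.- r/m) ℚ.+ ℚ.1ℚ) D/km ⟩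
  ℚ.toℚᵘ ((n/k ℚ.- r/m) ℚ.+ ℚ.1ℚ) ℚᵘ.+ ℚ.toℚᵘ D/km
    ≈⟨ ℚᵘP.+-congˡ (ℚ.toℚᵘ D/km) (ℚP.toℚᵘ-homo-+ (n/k ℚ.- r/m) ℚ.1ℚ) ⟩
  (ℚ.toℚᵘ (n/k ℚ.- r/m) ℚᵘ.+ ℚ.toℚᵘ ℚ.1ℚ) ℚᵘ.+ ℚ.toℚᵘ D/km
    ≈⟨ ℚᵘP.+-congˡ (ℚ.toℚᵘ D/km) (ℚᵘP.+-congˡ (ℚ.toℚᵘ ℚ.1ℚ) (ℚP.toℚᵘ-homo-+ n/k (ℚ.- r/m))) ⟩
  ((ℚ.toℚᵘ n/k ℚᵘ.+ ℚ.toℚᵘ (ℚ.- r/m)) ℚᵘ.+ ℚ.toℚᵘ ℚ.1ℚ) ℚᵘ.+ ℚ.toℚᵘ D/km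
    ≈⟨ ℚᵘP.+-cong (ℚᵘP.+-congˡ (ℚ.toℚᵘ ℚ.1ℚ) (ℚᵘP.+-cong (normal-form N k) negated-r/m))
                    (normal-form D (m + k * suc m)) ⟩
  ((mkℚᵘ N k ℚᵘ.- mkℚᵘ R m) ℚᵘ.+ mkℚᵘ ℤ.1ℤ 0) ℚᵘ.+ mkℚᵘ D (m + k * suc m)
    ≈⟨ *≡* (cross-multiplied N R D A (+ suc k) (+ suc m) hyp) ⟩
  mkℚᵘ (ℤ.1ℤ ℤ.+ A) 0
    ≈⟨ normal-form (ℤ.1ℤ ℤ.+ A) 0 ⟨
  ℚ.toℚᵘ (fromℤ (ℤ.1ℤ ℤ.+ A)) ∎)
  where
  open ℚᵘP.≃-Reasoning
  n/k r/m D/km : ℚ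
  n/k = frac N (suc k)
  r/m = frac R (suc m)
  D/km = frac D (suc k * suc m)
  normal-form : ∀ a b → ℚ.toℚᵘ (frac a (suc b)) ℚᵘ.≃ mkℚᵘ a b
  normal-form a b = ℚP.toℚᵘ-fromℚᵘ (mkℚᵘ a b)
  negated-r/m : ℚ.toℚᵘ (ℚ.- r/m) ℚᵘ.≃ ℚᵘ.- mkℚᵘ R m
  negated-r/m = ℚᵘP.≃-trans (ℚP.toℚᵘ-homo‿- r/m) (ℚᵘP.-‿cong (normal-form R m))

pos-sum-of-products : ∀ a b c e → + (a * b + c * e) ≡ + a ℤ.* + b ℤ.+ + c ℤ.* + e
pos-sum-of-products a b c e =
  trans (ℤP.pos-+ (a * b) (c * e)) (cong₂ ℤ._+_ (ℤP.pos-* a b) (ℤP.pos-* c e))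

pos-difference : ∀ a x → + (a + x) ℤ.- + a ≡ + x
pos-difference a x =
  trans (ℤP.[+m]-[+n]≡m⊖n (a + x) a) (trans (ℤP.≤-⊖ (m≤m+n a x)) (cong +_ (m+n∸m≡n a x)))

-- Since r < m, m is a successor, and then so is k = m + d: all denominators are
-- visibly positive and the three parts of the argument apply.
ceiling-identity : ∀ {n k d n₂ n₃ m q r} →
  n ≡ k * n₂ + suc k * n₃ → k ≡ m + d → n₃ ≡ q * m + r → 1 ≤ r → r < m →
  fromℤ (ℚ.ceiling (frac (+ n ℤ.- + (d * (n₂ + n₃))) m))
    ≡ ((frac (+ n) k ℚ.- frac (+ r) m) ℚ.+ ℚ.1ℚ) ℚ.+ frac (+ (d * n₃)) (k * m)
ceiling-identity {n} {_} {d} {n₂} {n₃} {suc m} {q} {r} n≡ refl n₃≡ 1≤r r<m = begin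
  fromℤ (ℚ.ceiling (frac (+ n ℤ.- + (d * (n₂ + n₃))) (suc m)))
    ≡⟨ cong (λ z → fromℤ (ℚ.ceiling (frac z (suc m)))) numerator ⟩
  fromℤ (ℚ.ceiling (frac (+ (r + A * suc m)) (suc m)))
    ≡⟨ cong fromℤ (ceiling-quotient-remainder A m r 1≤r r<m) ⟩
  fromℤ (+ suc A)
    ≡⟨ fraction-identity (+ n) (+ r) (+ (d * n₃)) (+ A) (m + d) m scaled ⟨
  ((frac (+ n) (suc m + d) ℚ.- frac (+ r) (suc m)) ℚ.+ ℚ.1ℚ)
    ℚ.+ frac (+ (d * n₃)) ((suc m + d) * suc m) ∎
  where
  open ≡-Reasoning
  A : ℕ
  A = n₂ + n₃ + q
  n-split : n ≡ d * (n₂ + n₃) + (r + A * suc m)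
  n-split = reduced-numerator {d = d} {n₂ = n₂} {m = suc m} {q = q} n≡ refl n₃≡
  scaledℕ : A * (suc (m + d) * suc m) + r * suc (m + d) ≡ n * suc m + d * n₃
  scaledℕ = scaled-identity {d = d} {n₂ = n₂} {m = suc m} {q = q} n≡ refl n₃≡
  numerator : + n ℤ.- + (d * (n₂ + n₃)) ≡ + (r + A * suc m)
  numerator = trans (cong (λ z → + z ℤ.- + (d * (n₂ + n₃))) n-split)
                    (pos-difference (d * (n₂ + n₃)) (r + A * suc m))
  scaled : + A ℤ.* (+ suc (m + d) ℤ.* + suc m) ℤ.+ + r ℤ.* + suc (m + d)
           ≡ + n ℤ.* + suc m ℤ.+ + (d * n₃)
  scaled = begin
    + A ℤ.* + (suc (m + d) * suc m) ℤ.+ + r ℤ.* + suc (m + d) ≡⟨ pos-sum-of-products A _ r _ ⟨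
    + (A * (suc (m + d) * suc m) + r * suc (m + d))           ≡⟨ cong +_ scaledℕ ⟩
    + (n * suc m + d * n₃)                                    ≡⟨ ℤP.pos-+ (n * suc m) (d * n₃) ⟩
    + (n * suc m) ℤ.+ + (d * n₃)                              ≡⟨ cong (ℤ._+ + (d * n₃)) (ℤP.pos-* n (suc m)) ⟩
    + n ℤ.* + suc m ℤ.+ + (d * n₃)                            ∎

-- The minor's parameters give n = 1·n = k n₂ + (k+1) n₃; and r < k − d forces
-- d < k, so k = (k − d) + d.
lemma4p1 : (n k d n₂ n₃ r : ℕ) → 2 ≤ k → k ≤ n ∸ 2 →
    CirculantMinorParams n k d 1 n₂ n₃ →
    Σ ℕ (λ q → n₃ ≡ q * (k ∸ d) + r) → 1 ≤ r → r < k ∸ d →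
    fromℤ (ℚ.ceiling (frac (+ n ℤ.- + (d * (n₂ + n₃))) (k ∸ d)))
    ≡ ((frac (+ n) k ℚ.- frac (+ r) (k ∸ d)) ℚ.+ ℚ.1ℚ) ℚ.+ frac (+ (d * n₃)) (k * (k ∸ d))
lemma4p1 n k d n₂ n₃ r _ _ (_ , 1·n≡ , _) (q , n₃≡) 1≤r r<k∸d =
  ceiling-identity {q = q} (trans (sym (*-identityˡ n)) 1·n≡) k≡[k∸d]+d n₃≡ 1≤r r<k∸d
  where
  d<k : d < k
  d<k = m∸n≢0⇒n<m (≢-sym (<⇒≢ (≤-<-trans z≤n r<k∸d)))
  k≡[k∸d]+d : k ≡ (k ∸ d) + d
  k≡[k∸d]+d = sym (m∸n+n≡m (<⇒≤ d<k))
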